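{- Let $G_S$ be a self-loop $4$-cycle with exactly two loops, i.e. $C_4$ with loops attached at the vertices of a set $S\subseteq V(C_4)$, $|S|=2$. Consider graphs $H$ obtained from $G_S$ by adding a finite set $W$ of new vertices which carry no loops and are pairwise non-adjacent, each new vertex being joined by edges to at least one vertex of $G_S$ (so $H$ is connected, contains a cycle, and has exactly two loops). Then, up to isomorphism, the graphs $H$ of this form which are triangle-free and have rank $3$ are exactly the graphs $H_2'$ in which $S$ consists of two opposite (non-adjacent) vertices of $C_4$, so that the two loopless vertices form an independent set $\mathcal{V}_I$, and every vertex of $W$ is adjacent to exactly the two vertices of $V(G_S)\setminus\mathcal{V}_I=S$ (that is, $H_2'$ is the join of $G_S$ with $W$ over $V(G_S)\setminus\mathcal{V}_I$).
   Context: A self-loop graph is a simple graph with a self-loop attached at each vertex of some subset $S$ of its vertices. Its adjacency matrix $A=(a_{ij})$ has $a_{ij}=1$ if $v_i$ and $v_j$ are joined by an edge (for $i\neq j$) or $v_i$ carries a loop (for $i=j$), and $a_{ij}=0$ otherwise; the rank of the graph is the rank of this matrix over $\mathbb{R}$. A triangle is a set of three distinct, pairwise adjacent vertices (loops are irrelevant). For a graph $G_1$, a subset $A\subseteq V(G_1)$ and a disjoint graph $G_2$, the join of $G_1$ and $G_2$ over $A$ is obtained from their disjoint union by joining every vertex of $A$ to every vertex of $G_2$, and no vertex of $V(G_1)\setminus A$ to any vertex of $G_2$. -}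

module Defs where

open import Data.Bool using (Bool; true; false; if_then_else_)
open import Data.Nat using (ℕ; zero; suc; _+_)
open import Data.Fin using (Fin; zero; suc; splitAt; _≟_)
open import Data.Fin.Subset using (Subset)
open import Data.Sum using (_⊎_; inj₁; inj₂)
open import Data.Product using (_×_; ∃)
open import Data.Vec using (lookup)
open import Data.Rational using (ℚ; 0ℚ; 1ℚ; _*_)
import Data.Rational as Q
open import Relation.Nullary using (¬_; does)
open import Relation.Binary.PropositionalEquality using (_≡_; _≢_)

∑ : ∀ {n} → (Fin n → ℚ) → ℚ
∑ {zero}  f = 0ℚ
∑ {suc n} f = f zero Q.+ ∑ (λ i → f (suc i))

LinIndep : ∀ {r n} → (Fin r → Fin n → ℚ) → Set
LinIndep {r} {n} v =
  (c : Fin r → ℚ) → (∀ j → ∑ (λ i → c i * v i j) ≡ 0ℚ) → ∀ i → c i ≡ 0ℚ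

HasRank : ∀ {m n} → (Fin m → Fin n → ℚ) → ℕ → Set
HasRank {m} M r =
  (∃ λ (f : Fin r → Fin m) → LinIndep (λ i → M (f i)))
  × ((g : Fin (suc r) → Fin m) → ¬ LinIndep (λ i → M (g i)))

b2q : Bool → ℚ
b2q true  = 1ℚ
b2q false = 0ℚ

c4 : Fin 4 → Fin 4 → Bool
c4 zero (suc zero) = true
c4 (suc zero) zero = true
c4 (suc zero) (suc (suc zero)) = true
c4 (suc (suc zero)) (suc zero) = true
c4 (suc (suc zero)) (suc (suc (suc zero))) = true
c4 (suc (suc (suc zero))) (suc (suc zero)) = true
c4 (suc (suc (suc zero))) zero = true
c4 zero (suc (suc (suc zero))) = true
c4 _ _ = false

-- The graph H: vertices Fin (4 + k); the first 4 are the C₄ vertices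
-- (with loops at S), the remaining k are the new vertices W, with
-- N w ⊆ V(C₄) the neighbourhood of w ∈ W.
adjH : ∀ {k} → Subset 4 → (Fin k → Subset 4) → Fin (4 + k) → Fin (4 + k) → Bool
adjH {k} S N u v = go (splitAt 4 u) (splitAt 4 v)
  where
  go : Fin 4 ⊎ Fin k → Fin 4 ⊎ Fin k → Bool
  go (inj₁ i) (inj₁ j) = if does (i ≟ j) then lookup S i else c4 i j
  go (inj₁ i) (inj₂ w) = lookup (N w) i
  go (inj₂ w) (inj₁ i) = lookup (N w) i
  go (inj₂ _) (inj₂ _) = false

adjMatrix : ∀ {k} → Subset 4 → (Fin k → Subset 4) → Fin (4 + k) → Fin (4 + k) → ℚ
adjMatrix S N u v = b2q (adjH S N u v)

TriangleFree : ∀ {n} → (Fin n → Fin n → Bool) → Set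
TriangleFree A = ∀ a b c → a ≢ b → b ≢ c → a ≢ c →
  ¬ (A a b ≡ true × A b c ≡ true × A a c ≡ true)

-- In a graph of rank 3 any four rows are linearly dependent, and so are any four rows of an
-- induced subgraph. With loops at two adjacent cycle vertices, G_S alone already has a unimodular
-- adjacency matrix. With opposite loops, look at the subgraph induced by C₄ and one new vertex w:
-- if N w contains an edge of C₄ there is a triangle, and every other nonempty N w ≠ S yields an
-- induced 4-vertex subgraph with invertible adjacency matrix. Conversely, when every new vertex is
-- joined exactly to S, the new vertices and the two loopless cycle vertices share one row, so H
-- is a blow-up of the path on three vertices with loops at both ends, whose adjacency matrix is
-- invertible; and a triangle in H would need an edge of C₄ inside S.

module Submission where

open import Defs
open import Agda.Builtin.FromNat using (Number; fromNat)
open import Agda.Builtin.FromNeg using (Negative)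
open import Algebra.Bundles using (CommutativeRing)
open import Data.Bool using (Bool; true; false; if_then_else_)
import Data.Bool.Properties as Bool
open import Data.Empty using (⊥-elim)
open import Data.Fin using (Fin; zero; suc; splitAt; join; lift; _↑ˡ_; _↑ʳ_; _≟_)
open import Data.Fin.Properties using (splitAt-↑ˡ; join-splitAt; lift-injective; pigeonhole; <⇒≢; all?)
import Data.Fin.Literals
open import Data.Fin.Subset using (Subset; ∣_∣; Nonempty)
open import Data.Fin.Subset.Properties using (∉⊥)
open import Data.Nat using (ℕ; zero; suc)
import Data.Nat as ℕ
open import Data.Nat.Properties using (n<1+n)
import Data.Nat.Literals
open import Data.Product using (_×_; _,_)
open import Data.Rational using (ℚ; 0ℚ; 1ℚ; ½; -½; _+_; _*_; -_; _-_)
open import Data.Rational.Properties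
  using (+-*-commutativeRing; *-assoc; *-comm; *-identityʳ; *-zeroˡ; *-zeroʳ; +-identityˡ; +-identityʳ; +-inverseʳ; *-distribʳ-+; neg-distribˡ-*; neg-distrib-+)
import Data.Rational.Properties as ℚ
import Data.Rational.Literals
open import Data.Sum using (_⊎_; inj₁; inj₂; map₂)
open import Data.Unit using (⊤; tt)
open import Data.Vec using (Vec; _∷_; []; lookup)
open import Function using (_∘_; id; case_of_; _⇔_; mk⇔)
open import Function.Definitions using (Injective)
open import Relation.Nullary using (¬_; Dec; does)
open import Relation.Nullary.Decidable using (True; toWitness; from-yes; dec-true; dec-false; ¬?; _×-dec_; _→-dec_)
open import Relation.Binary.PropositionalEquality

open import Algebra.Properties.Semiring.Sum (CommutativeRing.semiring +-*-commutativeRing)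
  using (sum; sum-cong-≗; sum-replicate-zero; ∑-comm; ∑-distrib-+; *-distribˡ-sum; *-distribʳ-sum)

instance
  ℕ-number : Number ℕ
  ℕ-number = Data.Nat.Literals.number
  Fin-number : ∀ {n} → Number (Fin n)
  Fin-number {n} = Data.Fin.Literals.number n
  ℚ-number : Number ℚ
  ℚ-number = Data.Rational.Literals.number
  ℚ-negative : Negative ℚ
  ℚ-negative = Data.Rational.Literals.negative
  ⊤-instance : ⊤
  ⊤-instance = tt

-- Linear algebra over ℚ
matrix : ∀ {A : Set} {m n} → Vec (Vec A n) m → Fin m → Fin n → A
matrix rows i j = lookup (lookup rows i) j

δ : ∀ {n} → Fin n → Fin n → ℚ
δ i j = b2q (does (i ≟ j))

δ-diagonal : ∀ {n} (i : Fin n) → δ i i ≡ 1ℚ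
δ-diagonal i = cong b2q (dec-true (i ≟ i) refl)

δ-offDiagonal : ∀ {n} {i j : Fin n} → i ≢ j → δ i j ≡ 0ℚ
δ-offDiagonal {i = i} {j} i≢j = cong b2q (dec-false (i ≟ j) i≢j)

∑≡sum : ∀ {n} (f : Fin n → ℚ) → ∑ f ≡ sum f
∑≡sum {zero} f = refl
∑≡sum {suc n} f = cong (f zero +_) (∑≡sum (f ∘ suc))

sum-δ : ∀ {n} (f : Fin n → ℚ) j → sum (λ i → f i * δ i j) ≡ f j
sum-δ {suc n} f zero = begin
  f zero * 1ℚ + sum (λ i → f (suc i) * 0ℚ)
    ≡⟨ cong₂ _+_ (*-identityʳ (f zero)) (sum-cong-≗ {n} (*-zeroʳ ∘ f ∘ suc)) ⟩
  f zero + sum (λ (_ : Fin n) → 0ℚ)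
    ≡⟨ cong (f zero +_) (sum-replicate-zero n) ⟩
  f zero + 0ℚ
    ≡⟨ +-identityʳ (f zero) ⟩
  f zero ∎
  where open ≡-Reasoning
sum-δ {suc n} f (suc j) = begin
  f zero * 0ℚ + sum (λ i → f (suc i) * δ i j)
    ≡⟨ cong₂ _+_ (*-zeroʳ (f zero)) (sum-δ (f ∘ suc) j) ⟩
  0ℚ + f (suc j)
    ≡⟨ +-identityˡ (f (suc j)) ⟩
  f (suc j) ∎
  where open ≡-Reasoning

sum-neg : ∀ {n} (f : Fin n → ℚ) → sum (λ i → - f i) ≡ - sum f
sum-neg {zero} f = refl
sum-neg {suc n} f = trans (cong (- f zero +_) (sum-neg (f ∘ suc))) (sym (neg-distrib-+ (f zero) (sum (f ∘ suc))))

LinIndep-restrict : ∀ {r n n'} {v : Fin r → Fin n → ℚ} {w : Fin r → Fin n' → ℚ} (κ : Fin n' → Fin n) →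
  (∀ i j → v i (κ j) ≡ w i j) → LinIndep w → LinIndep v
LinIndep-restrict {v = v} {w} κ v≡w indep c cv≡0 = indep c λ j → begin
  ∑ (λ i → c i * w i j)       ≡⟨ ∑≡sum (λ i → c i * w i j) ⟩
  sum (λ i → c i * w i j)     ≡⟨ sum-cong-≗ (λ i → cong (c i *_) (v≡w i j)) ⟨
  sum (λ i → c i * v i (κ j)) ≡⟨ ∑≡sum (λ i → c i * v i (κ j)) ⟨
  ∑ (λ i → c i * v i (κ j))   ≡⟨ cv≡0 (κ j) ⟩
  0ℚ ∎
  where open ≡-Reasoning

IsRightInverse : ∀ {r n} → (Fin r → Fin n → ℚ) → (Fin n → Fin r → ℚ) → Set
IsRightInverse v B = ∀ i i' → ∑ (λ l → v i l * B l i') ≡ δ i i'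

isRightInverse? : ∀ {r n} (v : Fin r → Fin n → ℚ) B → Dec (IsRightInverse v B)
isRightInverse? v B = all? λ i → all? λ i' → ∑ (λ l → v i l * B l i') ℚ.≟ δ i i'

rightInverse⇒LinIndep : ∀ {r n} {v : Fin r → Fin n → ℚ} B → IsRightInverse v B → LinIndep v
rightInverse⇒LinIndep {r} {n} {v} B vB≡I c cv≡0 i' = begin
  c i'                                            ≡⟨ sum-δ c i' ⟨
  sum (λ i → c i * δ i i')                         ≡⟨ sum-cong-≗ {r} (λ i → cong (c i *_) (trans (sym (vB≡I i i')) (∑≡sum (λ l → v i l * B l i')))) ⟩
  sum (λ i → c i * sum (λ l → v i l * B l i'))     ≡⟨ sum-cong-≗ {r} (λ i → *-distribˡ-sum (c i) (λ l → v i l * B l i')) ⟩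
  sum (λ i → sum (λ l → c i * (v i l * B l i')))   ≡⟨ ∑-comm (λ i l → c i * (v i l * B l i')) ⟩
  sum (λ l → sum (λ i → c i * (v i l * B l i')))   ≡⟨ sum-cong-≗ {n} (λ l → sum-cong-≗ {r} (λ i → *-assoc (c i) (v i l) (B l i'))) ⟨
  sum (λ l → sum (λ i → c i * v i l * B l i'))     ≡⟨ sum-cong-≗ {n} (λ l → *-distribʳ-sum (B l i') (λ i → c i * v i l)) ⟨
  sum (λ l → sum (λ i → c i * v i l) * B l i')     ≡⟨ sum-cong-≗ {n} (λ l → cong (_* B l i') (trans (sym (∑≡sum (λ i → c i * v i l))) (cv≡0 l))) ⟩
  sum (λ l → 0ℚ * B l i')                          ≡⟨ sum-cong-≗ {n} (λ l → *-zeroˡ (B l i')) ⟩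
  sum (λ (_ : Fin n) → 0ℚ)                         ≡⟨ sum-replicate-zero n ⟩
  0ℚ ∎
  where open ≡-Reasoning

equalRows⇒¬LinIndep : ∀ {r n} (v : Fin r → Fin n → ℚ) {i j} → i ≢ j → (∀ l → v i l ≡ v j l) → ¬ LinIndep v
equalRows⇒¬LinIndep {r} v {i} {j} i≢j vi≡vj indep = 1≢0 (trans (sym cᵢ≡1) (indep c combination≡0 i))
  where
  open ≡-Reasoning
  c : Fin r → ℚ
  c x = δ x i - δ x j
  cᵢ≡1 : c i ≡ 1ℚ
  cᵢ≡1 = cong₂ _-_ (δ-diagonal i) (δ-offDiagonal i≢j)
  1≢0 : 1ℚ ≢ 0ℚ
  1≢0 ()
  distribute : ∀ x l → c x * v x l ≡ v x l * δ x i + - (v x l * δ x j)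
  distribute x l = trans (*-distribʳ-+ (v x l) (δ x i) (- δ x j))
    (cong₂ _+_ (*-comm (δ x i) (v x l)) (trans (sym (neg-distribˡ-* (δ x j) (v x l))) (cong -_ (*-comm (δ x j) (v x l)))))
  combination≡0 : ∀ l → ∑ (λ x → c x * v x l) ≡ 0ℚ
  combination≡0 l = begin
    ∑ (λ x → c x * v x l)                                     ≡⟨ ∑≡sum (λ x → c x * v x l) ⟩
    sum (λ x → c x * v x l)                                   ≡⟨ sum-cong-≗ {r} (λ x → distribute x l) ⟩
    sum (λ x → v x l * δ x i + - (v x l * δ x j))             ≡⟨ ∑-distrib-+ (λ x → v x l * δ x i) (λ x → - (v x l * δ x j)) ⟩
    sum (λ x → v x l * δ x i) + sum (λ x → - (v x l * δ x j)) ≡⟨ cong₂ _+_ (sum-δ (λ x → v x l) i) (sum-neg (λ x → v x l * δ x j)) ⟩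
    v i l + - sum (λ x → v x l * δ x j)                       ≡⟨ cong (λ s → v i l + - s) (trans (sum-δ (λ x → v x l) j) (sym (vi≡vj l))) ⟩
    v i l + - v i l                                           ≡⟨ +-inverseʳ (v i l) ⟩
    0ℚ ∎

RankBelow : ∀ {m n} → (Fin m → Fin n → ℚ) → ℕ → Set
RankBelow {m} M r = (g : Fin r → Fin m) → ¬ LinIndep (λ i → M (g i))

RankBelow-induced : ∀ {m m' r} {M : Fin m → Fin m → ℚ} {M' : Fin m' → Fin m' → ℚ} (f : Fin m' → Fin m) →
  (∀ u v → M (f u) (f v) ≡ M' u v) → RankBelow M r → RankBelow M' r
RankBelow-induced f M≡M' below g indep = below (f ∘ g) (LinIndep-restrict f (λ i → M≡M' (g i)) indep)

invertibleMinor⇒¬RankBelow : ∀ {m r} (M : Fin m → Fin m → ℚ) (g : Fin r → Fin m) (B : Fin r → Fin r → ℚ) →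
  True (isRightInverse? (λ i j → M (g i) (g j)) B) → ¬ RankBelow M r
invertibleMinor⇒¬RankBelow M g B invertible below =
  below g (LinIndep-restrict g (λ _ _ → refl) (rightInverse⇒LinIndep B (toWitness invertible)))

HasRank-blowUp : ∀ {m r} {M : Fin m → Fin m → ℚ} (Q : Fin r → Fin r → ℚ) (π : Fin m → Fin r) (s : Fin r → Fin m) →
  (∀ i → π (s i) ≡ i) → (∀ u v → M u v ≡ Q (π u) (π v)) → LinIndep Q → HasRank M r
HasRank-blowUp {r = r} {M} Q π s πs≡id M≡Q indepQ = (s , LinIndep-restrict s representatives indepQ) , below
  where
  representatives : ∀ i j → M (s i) (s j) ≡ Q i j
  representatives i j = trans (M≡Q (s i) (s j)) (cong₂ Q (πs≡id i) (πs≡id j))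
  below : RankBelow M (suc r)
  below g with pigeonhole (n<1+n r) (π ∘ g)
  ... | i , j , i<j , πgᵢ≡πgⱼ = equalRows⇒¬LinIndep (M ∘ g) (<⇒≢ i<j)
    (λ l → trans (M≡Q (g i) l) (trans (cong (λ a → Q a (π l)) πgᵢ≡πgⱼ) (sym (M≡Q (g j) l))))

TriangleFree-induced : ∀ {m m'} {A : Fin m → Fin m → Bool} {A' : Fin m' → Fin m' → Bool} (f : Fin m' → Fin m) →
  Injective _≡_ _≡_ f → (∀ u v → A (f u) (f v) ≡ A' u v) → TriangleFree A → TriangleFree A'
TriangleFree-induced f f-injective A≡A' triangleFree a b c a≢b b≢c a≢c (ab , bc , ac) =
  triangleFree (f a) (f b) (f c) (a≢b ∘ f-injective) (b≢c ∘ f-injective) (a≢c ∘ f-injective)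
    (trans (A≡A' a b) ab , trans (A≡A' b c) bc , trans (A≡A' a c) ac)

-- The graph H
loopC4 : Subset 4 → Fin 4 → Fin 4 → Bool
loopC4 S i j = if does (i ≟ j) then lookup S i else c4 i j

loopC4Matrix : Subset 4 → Fin 4 → Fin 4 → ℚ
loopC4Matrix S i j = b2q (loopC4 S i j)

loopC4-offDiagonal : ∀ S {i j} → i ≢ j → loopC4 S i j ≡ c4 i j
loopC4-offDiagonal S {i} {j} i≢j = cong (if_then lookup S i else c4 i j) (dec-false (i ≟ j) i≢j)

c4-triangleFree : TriangleFree c4
c4-triangleFree a b c _ _ _ = from-yes
  (all? λ a → all? λ b → all? λ c → ¬? ((c4 a b Bool.≟ true) ×-dec (c4 b c Bool.≟ true) ×-dec (c4 a c Bool.≟ true))) a b c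

Independent : Subset 4 → Set
Independent T = ∀ i j → c4 i j ≡ true → ¬ (lookup T i ≡ true × lookup T j ≡ true)

independent? : ∀ T → Dec (Independent T)
independent? T = all? λ i → all? λ j → (c4 i j Bool.≟ true) →-dec ¬? ((lookup T i Bool.≟ true) ×-dec (lookup T j Bool.≟ true))

loops₀₂ loops₁₃ : Subset 4
loops₀₂ = true ∷ false ∷ true ∷ false ∷ []
loops₁₃ = false ∷ true ∷ false ∷ true ∷ []

Opposite : Subset 4 → Set
Opposite S = S ≡ loops₀₂ ⊎ S ≡ loops₁₃

starGraph : Subset 4 → Subset 4 → Fin 5 → Fin 5 → Bool
starGraph S T = adjH S (λ (_ : Fin 1) → T)

starMatrix : Subset 4 → Subset 4 → Fin 5 → Fin 5 → ℚ
starMatrix S T x y = b2q (starGraph S T x y)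

adjH-cong : ∀ {k} S {N N' : Fin k → Subset 4} → (∀ w → N w ≡ N' w) → ∀ u v → adjH S N u v ≡ adjH S N' u v
adjH-cong S N≡N' u v with splitAt 4 u | splitAt 4 v
... | inj₁ _ | inj₁ _ = refl
... | inj₁ i | inj₂ w = cong (λ T → lookup T i) (N≡N' w)
... | inj₂ w | inj₁ j = cong (λ T → lookup T j) (N≡N' w)
... | inj₂ _ | inj₂ _ = refl

splitAt-lift : ∀ m {k k'} (φ : Fin k' → Fin k) i → splitAt m (lift m φ i) ≡ map₂ φ (splitAt m i)
splitAt-lift zero φ i = refl
splitAt-lift (suc m) φ zero = refl
splitAt-lift (suc m) φ (suc i) rewrite splitAt-lift m φ i with splitAt m i
... | inj₁ _ = refl
... | inj₂ _ = refl

lift-↑ˡ : ∀ m {k k'} (φ : Fin k' → Fin k) (i : Fin m) → lift m φ (i ↑ˡ k') ≡ i ↑ˡ k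
lift-↑ˡ (suc m) φ zero = refl
lift-↑ˡ (suc m) φ (suc i) = cong suc (lift-↑ˡ m φ i)

adjH-lift : ∀ {k k'} S (N : Fin k → Subset 4) (φ : Fin k' → Fin k) u v →
  adjH S N (lift 4 φ u) (lift 4 φ v) ≡ adjH S (N ∘ φ) u v
adjH-lift S N φ u v rewrite splitAt-lift 4 φ u | splitAt-lift 4 φ v with splitAt 4 u | splitAt 4 v
... | inj₁ _ | inj₁ _ = refl
... | inj₁ _ | inj₂ _ = refl
... | inj₂ _ | inj₁ _ = refl
... | inj₂ _ | inj₂ _ = refl

TriangleFree-lift : ∀ {k k'} S (N : Fin k → Subset 4) (φ : Fin k' → Fin k) → Injective _≡_ _≡_ φ →
  TriangleFree (adjH S N) → TriangleFree (adjH S (N ∘ φ))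
TriangleFree-lift S N φ φ-injective = TriangleFree-induced (lift 4 φ) (lift-injective φ φ-injective 4) (adjH-lift S N φ)

RankBelow-lift : ∀ {k k' r} S (N : Fin k → Subset 4) (φ : Fin k' → Fin k) →
  RankBelow (adjMatrix S N) r → RankBelow (adjMatrix S (N ∘ φ)) r
RankBelow-lift S N φ =
  RankBelow-induced {M = adjMatrix S N} {M' = adjMatrix S (N ∘ φ)} (lift 4 φ) (λ u v → cong b2q (adjH-lift S N φ u v))

data Vertex (k : ℕ) : Fin (4 ℕ.+ k) → Set where
  cycle : (i : Fin 4) → Vertex k (i ↑ˡ k)
  added : (w : Fin k) → Vertex k (4 ↑ʳ w)

vertex : ∀ {k} (u : Fin (4 ℕ.+ k)) → Vertex k u
vertex {k} u = subst (Vertex k) (join-splitAt 4 k u) (fromSplit (splitAt 4 u))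
  where
  fromSplit : (x : Fin 4 ⊎ Fin k) → Vertex k (join 4 k x)
  fromSplit (inj₁ i) = cycle i
  fromSplit (inj₂ w) = added w

adjH-cycle-cycle : ∀ {k} S (N : Fin k → Subset 4) i j → adjH S N (i ↑ˡ k) (j ↑ˡ k) ≡ loopC4 S i j
adjH-cycle-cycle {k} S N i j rewrite splitAt-↑ˡ 4 i k | splitAt-↑ˡ 4 j k = refl

adjH-cycle-added : ∀ {k} S (N : Fin k → Subset 4) i w → adjH S N (i ↑ˡ k) (4 ↑ʳ w) ≡ lookup (N w) i
adjH-cycle-added {k} S N i w rewrite splitAt-↑ˡ 4 i k = refl

adjH-added-cycle : ∀ {k} S (N : Fin k → Subset 4) w i → adjH S N (4 ↑ʳ w) (i ↑ˡ k) ≡ lookup (N w) i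
adjH-added-cycle {k} S N w i rewrite splitAt-↑ˡ 4 i k = refl

cycleEdge : ∀ {k} S (N : Fin k → Subset 4) {i j} → i ↑ˡ k ≢ j ↑ˡ k →
  adjH S N (i ↑ˡ k) (j ↑ˡ k) ≡ true → c4 i j ≡ true
cycleEdge S N {i} {j} i≢j edge =
  trans (sym (loopC4-offDiagonal S (i≢j ∘ cong (_↑ˡ _)))) (trans (sym (adjH-cycle-cycle S N i j)) edge)

independent⇒TriangleFree : ∀ {k} S (N : Fin k → Subset 4) → (∀ w → Independent (N w)) → TriangleFree (adjH S N)
independent⇒TriangleFree S N independent a b c a≢b b≢c a≢c (ab , bc , ac) with vertex a | vertex b | vertex c
... | cycle i | cycle j | cycle l =
  c4-triangleFree i j l (a≢b ∘ cong (_↑ˡ _)) (b≢c ∘ cong (_↑ˡ _)) (a≢c ∘ cong (_↑ˡ _))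
    (cycleEdge S N a≢b ab , cycleEdge S N b≢c bc , cycleEdge S N a≢c ac)
... | cycle i | cycle j | added w = independent w i j (cycleEdge S N a≢b ab)
    (trans (sym (adjH-cycle-added S N i w)) ac , trans (sym (adjH-cycle-added S N j w)) bc)
... | cycle i | added w | cycle j = independent w i j (cycleEdge S N a≢c ac)
    (trans (sym (adjH-cycle-added S N i w)) ab , trans (sym (adjH-added-cycle S N w j)) bc)
... | added w | cycle i | cycle j = independent w i j (cycleEdge S N b≢c bc)
    (trans (sym (adjH-added-cycle S N w i)) ab , trans (sym (adjH-added-cycle S N w j)) ac)
... | _ | added _ | added _ = case bc of λ ()
... | added _ | _ | added _ = case ac of λ ()
... | added _ | added _ | _ = case ab of λ ()

RankBelow-cycle : ∀ {k r} S (N : Fin k → Subset 4) → RankBelow (adjMatrix S N) r → RankBelow (loopC4Matrix S) r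
RankBelow-cycle {k} S N =
  RankBelow-induced {M = adjMatrix S N} (_↑ˡ k) (λ i j → cong b2q (adjH-cycle-cycle S N i j))

HasRank-constantNeighbourhood : ∀ {k r} S T (N : Fin k → Subset 4) (Q : Fin r → Fin r → ℚ) (class : Fin 5 → Fin r) (rep : Fin r → Fin 4) →
  (∀ x y → starMatrix S T x y ≡ Q (class x) (class y)) → (∀ i → class (rep i ↑ˡ 1) ≡ i) → LinIndep Q →
  (∀ w → N w ≡ T) → HasRank (adjMatrix S N) r
HasRank-constantNeighbourhood {k} S T N Q class rep quotient section indepQ N≡T =
  HasRank-blowUp Q (class ∘ collapse) ((_↑ˡ k) ∘ rep) classOfRep entries indepQ
  where
  open ≡-Reasoning
  collapse : Fin (4 ℕ.+ k) → Fin 5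
  collapse = lift 4 (λ _ → zero)
  classOfRep : ∀ i → class (collapse (rep i ↑ˡ k)) ≡ i
  classOfRep i = trans (cong class (lift-↑ˡ 4 (λ _ → zero) (rep i))) (section i)
  entries : ∀ u v → adjMatrix S N u v ≡ Q (class (collapse u)) (class (collapse v))
  entries u v = begin
    b2q (adjH S N u v)                          ≡⟨ cong b2q (adjH-cong S N≡T u v) ⟩
    b2q (adjH S (λ _ → T) u v)                  ≡⟨ cong b2q (adjH-lift S (λ _ → T) (λ _ → zero) u v) ⟨
    starMatrix S T (collapse u) (collapse v)    ≡⟨ quotient (collapse u) (collapse v) ⟩
    Q (class (collapse u)) (class (collapse v)) ∎

-- The local configurations

-- With loops at two adjacent vertices the adjacency matrix of G_S is unimodular; each clause gives its inverse.
twoLoops-opposite : ∀ S → ∣ S ∣ ≡ 2 → RankBelow (loopC4Matrix S) 4 → Opposite S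
twoLoops-opposite (true ∷ false ∷ true ∷ false ∷ []) _ _ = inj₁ refl
twoLoops-opposite (false ∷ true ∷ false ∷ true ∷ []) _ _ = inj₂ refl
twoLoops-opposite S@(true ∷ true ∷ false ∷ false ∷ []) _ below =
  ⊥-elim (invertibleMinor⇒¬RankBelow (loopC4Matrix S) id
    (matrix (( 1 ∷  0 ∷ -1 ∷  0 ∷ []) ∷
             ( 0 ∷  1 ∷  0 ∷ -1 ∷ []) ∷
             (-1 ∷  0 ∷  1 ∷  1 ∷ []) ∷
             ( 0 ∷ -1 ∷  1 ∷  1 ∷ []) ∷ [])) _ below)
twoLoops-opposite S@(false ∷ true ∷ true ∷ false ∷ []) _ below =
  ⊥-elim (invertibleMinor⇒¬RankBelow (loopC4Matrix S) id
    (matrix (( 1 ∷  0 ∷ -1 ∷  1 ∷ []) ∷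
             ( 0 ∷  1 ∷  0 ∷ -1 ∷ []) ∷
             (-1 ∷  0 ∷  1 ∷  0 ∷ []) ∷
             ( 1 ∷ -1 ∷  0 ∷  1 ∷ []) ∷ [])) _ below)
twoLoops-opposite S@(false ∷ false ∷ true ∷ true ∷ []) _ below =
  ⊥-elim (invertibleMinor⇒¬RankBelow (loopC4Matrix S) id
    (matrix (( 1 ∷  1 ∷ -1 ∷  0 ∷ []) ∷
             ( 1 ∷  1 ∷  0 ∷ -1 ∷ []) ∷
             (-1 ∷  0 ∷  1 ∷  0 ∷ []) ∷
             ( 0 ∷ -1 ∷  0 ∷  1 ∷ []) ∷ [])) _ below)
twoLoops-opposite S@(true ∷ false ∷ false ∷ true ∷ []) _ below =
  ⊥-elim (invertibleMinor⇒¬RankBelow (loopC4Matrix S) id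
    (matrix (( 1 ∷  0 ∷ -1 ∷  0 ∷ []) ∷
             ( 0 ∷  1 ∷  1 ∷ -1 ∷ []) ∷
             (-1 ∷  1 ∷  1 ∷  0 ∷ []) ∷
             ( 0 ∷ -1 ∷  0 ∷  1 ∷ []) ∷ [])) _ below)
twoLoops-opposite (false ∷ false ∷ false ∷ false ∷ []) () _
twoLoops-opposite (false ∷ false ∷ false ∷ true ∷ []) () _
twoLoops-opposite (false ∷ false ∷ true ∷ false ∷ []) () _
twoLoops-opposite (false ∷ true ∷ false ∷ false ∷ []) () _
twoLoops-opposite (true ∷ false ∷ false ∷ false ∷ []) () _
twoLoops-opposite (false ∷ true ∷ true ∷ true ∷ []) () _
twoLoops-opposite (true ∷ false ∷ true ∷ true ∷ []) () _
twoLoops-opposite (true ∷ true ∷ false ∷ true ∷ []) () _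
twoLoops-opposite (true ∷ true ∷ true ∷ _ ∷ []) () _

-- Unless T = S, either T contains an edge of C₄, which closes a triangle with the new vertex 4,
-- or the four listed vertices induce a subgraph whose adjacency matrix has the given inverse.
neighbourhood-loops₀₂ : ∀ T → Nonempty T → TriangleFree (starGraph loops₀₂ T) → RankBelow (starMatrix loops₀₂ T) 4 → T ≡ loops₀₂
neighbourhood-loops₀₂ (true ∷ false ∷ true ∷ false ∷ []) _ _ _ = refl
neighbourhood-loops₀₂ (true ∷ true ∷ _ ∷ _ ∷ []) _ triangleFree _ =
  ⊥-elim (triangleFree 0 1 4 (λ ()) (λ ()) (λ ()) (refl , refl , refl))
neighbourhood-loops₀₂ (_ ∷ true ∷ true ∷ _ ∷ []) _ triangleFree _ =
  ⊥-elim (triangleFree 1 2 4 (λ ()) (λ ()) (λ ()) (refl , refl , refl))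
neighbourhood-loops₀₂ (_ ∷ _ ∷ true ∷ true ∷ []) _ triangleFree _ =
  ⊥-elim (triangleFree 2 3 4 (λ ()) (λ ()) (λ ()) (refl , refl , refl))
neighbourhood-loops₀₂ (true ∷ _ ∷ _ ∷ true ∷ []) _ triangleFree _ =
  ⊥-elim (triangleFree 0 3 4 (λ ()) (λ ()) (λ ()) (refl , refl , refl))
neighbourhood-loops₀₂ (false ∷ false ∷ false ∷ false ∷ []) (_ , i∈∅) _ _ = ⊥-elim (∉⊥ i∈∅)
neighbourhood-loops₀₂ T@(true ∷ false ∷ false ∷ false ∷ []) _ _ below =
  ⊥-elim (invertibleMinor⇒¬RankBelow (starMatrix loops₀₂ T) (lookup (0 ∷ 1 ∷ 2 ∷ 4 ∷ []))
    (matrix (( 0 ∷  0 ∷  0 ∷  1 ∷ []) ∷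
             ( 0 ∷ -1 ∷  1 ∷  1 ∷ []) ∷
             ( 0 ∷  1 ∷  0 ∷ -1 ∷ []) ∷
             ( 1 ∷  1 ∷ -1 ∷ -2 ∷ []) ∷ [])) _ below)
neighbourhood-loops₀₂ T@(false ∷ true ∷ false ∷ false ∷ []) _ _ below =
  ⊥-elim (invertibleMinor⇒¬RankBelow (starMatrix loops₀₂ T) (lookup (0 ∷ 1 ∷ 3 ∷ 4 ∷ []))
    (matrix (( 0 ∷  0 ∷  1 ∷  0 ∷ []) ∷
             ( 0 ∷  0 ∷  0 ∷  1 ∷ []) ∷
             ( 1 ∷  0 ∷ -1 ∷ -1 ∷ []) ∷
             ( 0 ∷  1 ∷ -1 ∷  0 ∷ []) ∷ [])) _ below)
neighbourhood-loops₀₂ T@(false ∷ false ∷ true ∷ false ∷ []) _ _ below =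
  ⊥-elim (invertibleMinor⇒¬RankBelow (starMatrix loops₀₂ T) (lookup (0 ∷ 1 ∷ 2 ∷ 4 ∷ []))
    (matrix (( 0 ∷  1 ∷  0 ∷ -1 ∷ []) ∷
             ( 1 ∷ -1 ∷  0 ∷  1 ∷ []) ∷
             ( 0 ∷  0 ∷  0 ∷  1 ∷ []) ∷
             (-1 ∷  1 ∷  1 ∷ -2 ∷ []) ∷ [])) _ below)
neighbourhood-loops₀₂ T@(false ∷ false ∷ false ∷ true ∷ []) _ _ below =
  ⊥-elim (invertibleMinor⇒¬RankBelow (starMatrix loops₀₂ T) (lookup (0 ∷ 1 ∷ 3 ∷ 4 ∷ []))
    (matrix (( 0 ∷  1 ∷  0 ∷  0 ∷ []) ∷
             ( 1 ∷ -1 ∷  0 ∷ -1 ∷ []) ∷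
             ( 0 ∷  0 ∷  0 ∷  1 ∷ []) ∷
             ( 0 ∷ -1 ∷  1 ∷  0 ∷ []) ∷ [])) _ below)
neighbourhood-loops₀₂ T@(false ∷ true ∷ false ∷ true ∷ []) _ _ below =
  ⊥-elim (invertibleMinor⇒¬RankBelow (starMatrix loops₀₂ T) (lookup (0 ∷ 1 ∷ 2 ∷ 4 ∷ []))
    (matrix (( 1 ∷  0 ∷  0 ∷ -1 ∷ []) ∷
             ( 0 ∷  0 ∷  0 ∷  1 ∷ []) ∷
             ( 0 ∷  0 ∷  1 ∷ -1 ∷ []) ∷
             (-1 ∷  1 ∷ -1 ∷  2 ∷ []) ∷ [])) _ below)

neighbourhood-loops₁₃ : ∀ T → Nonempty T → TriangleFree (starGraph loops₁₃ T) → RankBelow (starMatrix loops₁₃ T) 4 → T ≡ loops₁₃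
neighbourhood-loops₁₃ (false ∷ true ∷ false ∷ true ∷ []) _ _ _ = refl
neighbourhood-loops₁₃ (true ∷ true ∷ _ ∷ _ ∷ []) _ triangleFree _ =
  ⊥-elim (triangleFree 0 1 4 (λ ()) (λ ()) (λ ()) (refl , refl , refl))
neighbourhood-loops₁₃ (_ ∷ true ∷ true ∷ _ ∷ []) _ triangleFree _ =
  ⊥-elim (triangleFree 1 2 4 (λ ()) (λ ()) (λ ()) (refl , refl , refl))
neighbourhood-loops₁₃ (_ ∷ _ ∷ true ∷ true ∷ []) _ triangleFree _ =
  ⊥-elim (triangleFree 2 3 4 (λ ()) (λ ()) (λ ()) (refl , refl , refl))
neighbourhood-loops₁₃ (true ∷ _ ∷ _ ∷ true ∷ []) _ triangleFree _ =
  ⊥-elim (triangleFree 0 3 4 (λ ()) (λ ()) (λ ()) (refl , refl , refl))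
neighbourhood-loops₁₃ (false ∷ false ∷ false ∷ false ∷ []) (_ , i∈∅) _ _ = ⊥-elim (∉⊥ i∈∅)
neighbourhood-loops₁₃ T@(true ∷ false ∷ false ∷ false ∷ []) _ _ below =
  ⊥-elim (invertibleMinor⇒¬RankBelow (starMatrix loops₁₃ T) (lookup (0 ∷ 1 ∷ 2 ∷ 4 ∷ []))
    (matrix (( 0 ∷  0 ∷  0 ∷  1 ∷ []) ∷
             ( 0 ∷  0 ∷  1 ∷  0 ∷ []) ∷
             ( 0 ∷  1 ∷ -1 ∷ -1 ∷ []) ∷
             ( 1 ∷  0 ∷ -1 ∷  0 ∷ []) ∷ [])) _ below)
neighbourhood-loops₁₃ T@(false ∷ true ∷ false ∷ false ∷ []) _ _ below =
  ⊥-elim (invertibleMinor⇒¬RankBelow (starMatrix loops₁₃ T) (lookup (1 ∷ 2 ∷ 3 ∷ 4 ∷ []))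
    (matrix (( 0 ∷  0 ∷  0 ∷  1 ∷ []) ∷
             ( 0 ∷ -1 ∷  1 ∷  1 ∷ []) ∷
             ( 0 ∷  1 ∷  0 ∷ -1 ∷ []) ∷
             ( 1 ∷  1 ∷ -1 ∷ -2 ∷ []) ∷ [])) _ below)
neighbourhood-loops₁₃ T@(false ∷ false ∷ true ∷ false ∷ []) _ _ below =
  ⊥-elim (invertibleMinor⇒¬RankBelow (starMatrix loops₁₃ T) (lookup (0 ∷ 1 ∷ 2 ∷ 4 ∷ []))
    (matrix ((-1 ∷  1 ∷  0 ∷ -1 ∷ []) ∷
             ( 1 ∷  0 ∷  0 ∷  0 ∷ []) ∷
             ( 0 ∷  0 ∷  0 ∷  1 ∷ []) ∷
             (-1 ∷  0 ∷  1 ∷  0 ∷ []) ∷ [])) _ below)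
neighbourhood-loops₁₃ T@(false ∷ false ∷ false ∷ true ∷ []) _ _ below =
  ⊥-elim (invertibleMinor⇒¬RankBelow (starMatrix loops₁₃ T) (lookup (1 ∷ 2 ∷ 3 ∷ 4 ∷ []))
    (matrix (( 0 ∷  1 ∷  0 ∷ -1 ∷ []) ∷
             ( 1 ∷ -1 ∷  0 ∷  1 ∷ []) ∷
             ( 0 ∷  0 ∷  0 ∷  1 ∷ []) ∷
             (-1 ∷  1 ∷  1 ∷ -2 ∷ []) ∷ [])) _ below)
neighbourhood-loops₁₃ T@(true ∷ false ∷ true ∷ false ∷ []) _ _ below =
  ⊥-elim (invertibleMinor⇒¬RankBelow (starMatrix loops₁₃ T) (lookup (1 ∷ 2 ∷ 3 ∷ 4 ∷ []))
    (matrix (( 1 ∷  0 ∷  0 ∷ -1 ∷ []) ∷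
             ( 0 ∷  0 ∷  0 ∷  1 ∷ []) ∷
             ( 0 ∷  0 ∷  1 ∷ -1 ∷ []) ∷
             (-1 ∷  1 ∷ -1 ∷  2 ∷ []) ∷ [])) _ below)

pathWithLoopedEnds : Fin 3 → Fin 3 → ℚ
pathWithLoopedEnds = matrix ((1 ∷ 1 ∷ 0 ∷ []) ∷ (1 ∷ 0 ∷ 1 ∷ []) ∷ (0 ∷ 1 ∷ 1 ∷ []) ∷ [])

pathWithLoopedEnds-independent : LinIndep pathWithLoopedEnds
pathWithLoopedEnds-independent =
  rightInverse⇒LinIndep {v = pathWithLoopedEnds} B (from-yes (isRightInverse? pathWithLoopedEnds B))
  where
  B : Fin 3 → Fin 3 → ℚ
  B = matrix ((½ ∷ ½ ∷ -½ ∷ []) ∷ (½ ∷ -½ ∷ ½ ∷ []) ∷ (-½ ∷ ½ ∷ ½ ∷ []) ∷ [])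

HasRank-blowUpOfPath : ∀ {k} S (N : Fin k → Subset 4) (class : Vec (Fin 3) 5) (rep : Vec (Fin 4) 3) →
  True (all? λ x → all? λ y → starMatrix S S x y ℚ.≟ pathWithLoopedEnds (lookup class x) (lookup class y)) →
  True (all? λ i → lookup class (lookup rep i ↑ˡ 1) ≟ i) →
  (∀ w → N w ≡ S) → HasRank (adjMatrix S N) 3
HasRank-blowUpOfPath S N class rep quotient section =
  HasRank-constantNeighbourhood S S N pathWithLoopedEnds (lookup class) (lookup rep)
    (toWitness quotient) (toWitness section) pathWithLoopedEnds-independent

oppositeLoops-rank3 : ∀ {k S} (N : Fin k → Subset 4) → Opposite S → (∀ w → N w ≡ S) → HasRank (adjMatrix S N) 3
-- Classes 0 and 2 are the two loop vertices; class 1 holds the loopless cycle vertices and the new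
-- vertex, which all have neighbourhood S.
oppositeLoops-rank3 N (inj₁ refl) = HasRank-blowUpOfPath loops₀₂ N (0 ∷ 1 ∷ 2 ∷ 1 ∷ 1 ∷ []) (0 ∷ 1 ∷ 2 ∷ []) _ _
oppositeLoops-rank3 N (inj₂ refl) = HasRank-blowUpOfPath loops₁₃ N (1 ∷ 0 ∷ 1 ∷ 2 ∷ 1 ∷ []) (1 ∷ 0 ∷ 3 ∷ []) _ _

oppositeLoops-independent : ∀ {S} → Opposite S → Independent S
oppositeLoops-independent (inj₁ refl) = from-yes (independent? loops₀₂)
oppositeLoops-independent (inj₂ refl) = from-yes (independent? loops₁₃)

oppositeLoops-neighbourhood : ∀ {S T} → Opposite S → Nonempty T → TriangleFree (starGraph S T) → RankBelow (starMatrix S T) 4 → T ≡ S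
oppositeLoops-neighbourhood (inj₁ refl) = neighbourhood-loops₀₂ _
oppositeLoops-neighbourhood (inj₂ refl) = neighbourhood-loops₁₃ _

mainTheorem3 : (k : ℕ) (S : Subset 4) (N : Fin k → Subset 4) →
    ∣ S ∣ ≡ 2 → (∀ w → Nonempty (N w)) →
    (TriangleFree (adjH S N) × HasRank (adjMatrix S N) 3)
      ⇔ ((S ≡ true ∷ false ∷ true ∷ false ∷ [] ⊎ S ≡ false ∷ true ∷ false ∷ true ∷ [])
         × (∀ w → N w ≡ S))
mainTheorem3 k S N twoLoops nonempty = mk⇔ forward backward
  where
  forward : TriangleFree (adjH S N) × HasRank (adjMatrix S N) 3 → Opposite S × (∀ w → N w ≡ S)
  forward (triangleFree , _ , below4) = opposite , λ w →
    oppositeLoops-neighbourhood opposite (nonempty w)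
      (TriangleFree-lift S N (λ _ → w) (λ { {zero} {zero} _ → refl }) triangleFree)
      (RankBelow-lift S N (λ _ → w) below4)
    where
    opposite : Opposite S
    opposite = twoLoops-opposite S twoLoops (RankBelow-cycle S N below4)
  backward : Opposite S × (∀ w → N w ≡ S) → TriangleFree (adjH S N) × HasRank (adjMatrix S N) 3
  backward (opposite , N≡S) =
    independent⇒TriangleFree S N (λ w → subst Independent (sym (N≡S w)) (oppositeLoops-independent opposite)) ,
    oppositeLoops-rank3 N opposite N≡S
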